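{- Let $G=(C\cup S,E)$ be a finite bipartite graph with $C\ne\emptyset$ and $|N(c)|\ge1$ for all $c\in C$. If $\max_{\emptyset\subset K\subseteq C}\frac{|K|}{|N(K)|}=\frac{|C|}{|S|}$, then there is a unique balanced server flow (namely the one with $\alpha(s)=|C|/|S|$ for all $s$).
   Context: A server flow is a map $\alpha:S\to\mathbb R_{\ge0}$ for which there exist nonnegative reals $(x_e)_{e\in E}$ with $\sum_{s\in N(c)}x_{cs}=1$ for every $c\in C$ and $\sum_{c\in N(s)}x_{cs}=\alpha(s)$ for every $s\in S$. It is balanced if such $x$ can be chosen with $x_{cs}=0$ whenever $s\in N(c)\setminus\arg\min_{s'\in N(c)}\alpha(s')$. $N(K)=\bigcup_{c\in K}N(c)$.
   Formalization: The server flows $\alpha$ and the edge values $x_e$ take values in the nonnegative rationals instead of the nonnegative reals. -}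

module Defs where

open import Data.Nat as ℕ using (ℕ)
open import Data.Integer using (+_)
open import Data.Bool using (Bool; true; false; _∧_; if_then_else_)
open import Data.Fin using (Fin)
open import Data.Fin.Subset using (Subset; _∈_; ∣_∣; Nonempty)
open import Data.Vec using (tabulate; lookup)
open import Data.List using (List; allFin; foldr)
open import Data.Bool.ListAction using (any)
open import Data.Rational using (ℚ; 0ℚ; 1ℚ; _+_; _*_; _/_; _≤_; _<_)
open import Data.Product using (Σ; _×_; ∃)
open import Relation.Binary.PropositionalEquality using (_≡_)
open import Relation.Nullary using (¬_)

-- A finite bipartite graph G = (C ∪ S, E) with C = Fin m, S = Fin n,
-- given by its biadjacency relation: adj c s = true iff cs ∈ E.
BiGraph : ℕ → ℕ → Set
BiGraph m n = Fin m → Fin n → Bool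

ℕ→ℚ : ℕ → ℚ
ℕ→ℚ k = + k / 1

sumWhere : ∀ {n} → (Fin n → Bool) → (Fin n → ℚ) → ℚ
sumWhere {n} p f = foldr (λ s acc → (if p s then f s else 0ℚ) + acc) 0ℚ (allFin n)

N : ∀ {m n} → BiGraph m n → Subset m → Subset n
N {m} adj K = tabulate (λ s → any (λ c → lookup K c ∧ adj c s) (allFin m))

Nˢ : ∀ {m n} → BiGraph m n → Fin n → Fin m → Bool
Nˢ adj s c = adj c s

IsFlowFor : ∀ {m n} → BiGraph m n → (Fin n → ℚ) → (Fin m → Fin n → ℚ) → Set
IsFlowFor {m} {n} adj α x =
  (∀ c s → adj c s ≡ true → 0ℚ ≤ x c s)
  × (∀ c → sumWhere (adj c) (x c) ≡ 1ℚ)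
  × (∀ s → sumWhere (Nˢ adj s) (λ c → x c s) ≡ α s)

IsServerFlow : ∀ {m n} → BiGraph m n → (Fin n → ℚ) → Set
IsServerFlow {m} {n} adj α =
  (∀ s → 0ℚ ≤ α s) × Σ (Fin m → Fin n → ℚ) (IsFlowFor adj α)

InArgmin : ∀ {m n} → BiGraph m n → (Fin n → ℚ) → Fin m → Fin n → Set
InArgmin adj α c s = adj c s ≡ true × (∀ s' → adj c s' ≡ true → α s ≤ α s')

IsBalanced : ∀ {m n} → BiGraph m n → (Fin n → ℚ) → Set
IsBalanced {m} {n} adj α =
  (∀ s → 0ℚ ≤ α s)
  × Σ (Fin m → Fin n → ℚ) (λ x →
      IsFlowFor adj α x
      × (∀ c s → adj c s ≡ true → ¬ InArgmin adj α c s → x c s ≡ 0ℚ))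

-- max_{∅ ⊂ K ⊆ C} |K| / |N(K)| = p / q, with ratios compared by cross-multiplication
-- (all denominators are positive under the standing hypotheses):
-- every ratio is ≤ p/q and some ratio equals p/q.
MaxRatioIs : ∀ {m n} → BiGraph m n → ℕ → ℕ → Set
MaxRatioIs {m} adj p q =
  (∀ (K : Subset m) → Nonempty K → ∣ K ∣ ℕ.* q ℕ.≤ p ℕ.* ∣ N adj K ∣)
  × ∃ (λ (K : Subset m) → Nonempty K × (∣ K ∣ ℕ.* q ≡ p ℕ.* ∣ N adj K ∣))

{-# OPTIONS --safe #-}

-- Existence: the hypothesis gives |K|·|S| ≤ |C|·|N(K)| for all K ⊆ C, which is Hall's
-- condition for supplying |S| units to every client from servers of capacity |C|. Hall's
-- theorem for such demands (induction on the total demand: route one unit along an edge c s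
-- after which the condition still holds; if there is none, the tight sets blocking every s
-- unite, by submodularity, to a tight set that together with c violates the condition)
-- gives an integral allocation. Total demand equals total capacity, so every server gets
-- exactly |C|, and dividing by |S| yields a flow with α ≡ |C|/|S|, trivially balanced.
--
-- Uniqueness: let β be balanced with maximum M, attained on the servers T, and let K be the
-- clients all of whose neighbours lie in T. A client outside K has a neighbour below M, so
-- by balancedness it sends nothing into T, while clients of K send everything there. Hence
-- |T|·M = |K| ≤ |C|·|N(K)|/|S| ≤ |C|·|T|/|S|, so M is at most |C|/|S|, the mean of β.

module Submission where

open import Defs
open import Algebra.Bundles using (CommutativeMonoid)

module FiniteSums {c ℓ} (M : CommutativeMonoid c ℓ) where

  open import Data.Fin using (Fin; zero; suc)
  open import Data.Fin.Subset using (Subset; inside; outside; _∈_; _∉_; _∪_; _∩_; ⊥; ⁅_⁆)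
  open import Data.Fin.Subset.Properties using (∉⊥; drop-there)
  open import Data.Nat using (zero; suc)
  open import Data.Vec using ([]; _∷_; here; there)
  open import Function using (_∘_)
  open import Relation.Nullary using (contradiction)

  open CommutativeMonoid M
    using (Carrier; _≈_; setoid; commutativeSemigroup)
    renaming (_∙_ to _+_; ε to 0#; ∙-cong to +-cong; ∙-congˡ to +-congˡ;
              identityˡ to +-identityˡ; identityʳ to +-identityʳ; assoc to +-assoc;
              refl to ≈-refl; sym to ≈-sym; trans to ≈-trans)
  open import Algebra.Properties.CommutativeMonoid.Sum M public using (sum; sum-replicate-zero)
  open import Algebra.Properties.CommutativeSemigroup commutativeSemigroup
    using (interchange; x∙yz≈y∙xz)
  open import Relation.Binary.Reasoning.Setoid setoid

  sum-+ : ∀ {n} (f g : Fin n → Carrier) → sum (λ i → f i + g i) ≈ sum f + sum g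
  sum-+ {zero}  f g = ≈-sym (+-identityˡ 0#)
  sum-+ {suc n} f g = ≈-trans (+-congˡ (sum-+ (f ∘ suc) (g ∘ suc))) (interchange _ _ _ _)

  sum-swap : ∀ {m n} (f : Fin m → Fin n → Carrier) →
             sum (λ i → sum (f i)) ≈ sum (λ j → sum (λ i → f i j))
  sum-swap {zero}  {n} f = ≈-sym (sum-replicate-zero n)
  sum-swap {suc m}     f = ≈-trans (+-congˡ (sum-swap (f ∘ suc))) (≈-sym (sum-+ (f zero) _))

  Σ⟨_⟩ : ∀ {n} → Subset n → (Fin n → Carrier) → Carrier
  Σ⟨ []          ⟩ f = 0#
  Σ⟨ inside  ∷ K ⟩ f = f zero + Σ⟨ K ⟩ (f ∘ suc)
  Σ⟨ outside ∷ K ⟩ f = Σ⟨ K ⟩ (f ∘ suc)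

  Σ⟨⟩-cong : ∀ {n} (K : Subset n) {f g : Fin n → Carrier} →
             (∀ {i} → i ∈ K → f i ≈ g i) → Σ⟨ K ⟩ f ≈ Σ⟨ K ⟩ g
  Σ⟨⟩-cong []            f≈g = ≈-refl
  Σ⟨⟩-cong (inside  ∷ K) f≈g = +-cong (f≈g here) (Σ⟨⟩-cong K (f≈g ∘ there))
  Σ⟨⟩-cong (outside ∷ K) f≈g = Σ⟨⟩-cong K (f≈g ∘ there)

  Σ⟨⟩-zero : ∀ {n} (K : Subset n) {f : Fin n → Carrier} →
             (∀ {i} → i ∈ K → f i ≈ 0#) → Σ⟨ K ⟩ f ≈ 0#
  Σ⟨⟩-zero []            f≈0 = ≈-refl
  Σ⟨⟩-zero (inside  ∷ K) f≈0 = ≈-trans (+-cong (f≈0 here) (Σ⟨⟩-zero K (f≈0 ∘ there))) (+-identityˡ 0#)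
  Σ⟨⟩-zero (outside ∷ K) f≈0 = Σ⟨⟩-zero K (f≈0 ∘ there)

  Σ⟨⊥⟩ : ∀ {n} (f : Fin n → Carrier) → Σ⟨ ⊥ ⟩ f ≈ 0#
  Σ⟨⊥⟩ {n} f = Σ⟨⟩-zero (⊥ {n}) (λ i∈⊥ → contradiction i∈⊥ ∉⊥)

  Σ⟨⁅_⁆⟩ : ∀ {n} (i : Fin n) (f : Fin n → Carrier) → Σ⟨ ⁅ i ⁆ ⟩ f ≈ f i
  Σ⟨⁅ zero  ⁆⟩ f = ≈-trans (+-congˡ (Σ⟨⊥⟩ (f ∘ suc))) (+-identityʳ (f zero))
  Σ⟨⁅ suc i ⁆⟩ f = Σ⟨⁅ i ⁆⟩ (f ∘ suc)

  Σ⟨⟩≈sum : ∀ {n} (K : Subset n) {f : Fin n → Carrier} →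
            (∀ {i} → i ∉ K → f i ≈ 0#) → Σ⟨ K ⟩ f ≈ sum f
  Σ⟨⟩≈sum []            f≈0 = ≈-refl
  Σ⟨⟩≈sum (inside  ∷ K) f≈0 = +-congˡ (Σ⟨⟩≈sum K (λ i∉K → f≈0 (i∉K ∘ drop-there)))
  Σ⟨⟩≈sum (outside ∷ K) {f} f≈0 = begin
    Σ⟨ K ⟩ (f ∘ suc)         ≈⟨ Σ⟨⟩≈sum K (λ i∉K → f≈0 (i∉K ∘ drop-there)) ⟩
    sum (f ∘ suc)            ≈⟨ +-identityˡ _ ⟨
    0# + sum (f ∘ suc)       ≈⟨ +-cong (f≈0 (λ ())) ≈-refl ⟨
    f zero + sum (f ∘ suc)   ∎

  Σ⟨⟩-+ : ∀ {n} (K : Subset n) (f g : Fin n → Carrier) →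
          Σ⟨ K ⟩ (λ i → f i + g i) ≈ Σ⟨ K ⟩ f + Σ⟨ K ⟩ g
  Σ⟨⟩-+ []            f g = ≈-sym (+-identityˡ 0#)
  Σ⟨⟩-+ (inside  ∷ K) f g = ≈-trans (+-congˡ (Σ⟨⟩-+ K (f ∘ suc) (g ∘ suc))) (interchange _ _ _ _)
  Σ⟨⟩-+ (outside ∷ K) f g = Σ⟨⟩-+ K (f ∘ suc) (g ∘ suc)

  Σ⟨⟩-sum-swap : ∀ {m n} (K : Subset n) (f : Fin m → Fin n → Carrier) →
                 Σ⟨ K ⟩ (λ j → sum (λ i → f i j)) ≈ sum (λ i → Σ⟨ K ⟩ (f i))
  Σ⟨⟩-sum-swap {m} []  f = ≈-sym (sum-replicate-zero m)
  Σ⟨⟩-sum-swap (inside  ∷ K) f =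
    ≈-trans (+-congˡ (Σ⟨⟩-sum-swap K (λ i → f i ∘ suc))) (≈-sym (sum-+ (λ i → f i zero) _))
  Σ⟨⟩-sum-swap (outside ∷ K) f = Σ⟨⟩-sum-swap K (λ i → f i ∘ suc)

  Σ⟨⟩-∪-∩ : ∀ {n} (A B : Subset n) (f : Fin n → Carrier) →
            Σ⟨ A ∪ B ⟩ f + Σ⟨ A ∩ B ⟩ f ≈ Σ⟨ A ⟩ f + Σ⟨ B ⟩ f
  Σ⟨⟩-∪-∩ []            []            f = ≈-refl
  Σ⟨⟩-∪-∩ (inside  ∷ A) (inside  ∷ B) f = begin
    (f zero + Σ⟨ A ∪ B ⟩ g) + (f zero + Σ⟨ A ∩ B ⟩ g) ≈⟨ interchange _ _ _ _ ⟩
    (f zero + f zero) + (Σ⟨ A ∪ B ⟩ g + Σ⟨ A ∩ B ⟩ g) ≈⟨ +-congˡ (Σ⟨⟩-∪-∩ A B g) ⟩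
    (f zero + f zero) + (Σ⟨ A ⟩ g + Σ⟨ B ⟩ g)         ≈⟨ interchange _ _ _ _ ⟩
    (f zero + Σ⟨ A ⟩ g) + (f zero + Σ⟨ B ⟩ g)         ∎
    where g = f ∘ suc
  Σ⟨⟩-∪-∩ (inside  ∷ A) (outside ∷ B) f = begin
    (f zero + Σ⟨ A ∪ B ⟩ g) + Σ⟨ A ∩ B ⟩ g  ≈⟨ +-assoc _ _ _ ⟩
    f zero + (Σ⟨ A ∪ B ⟩ g + Σ⟨ A ∩ B ⟩ g)  ≈⟨ +-congˡ (Σ⟨⟩-∪-∩ A B g) ⟩
    f zero + (Σ⟨ A ⟩ g + Σ⟨ B ⟩ g)          ≈⟨ +-assoc _ _ _ ⟨
    (f zero + Σ⟨ A ⟩ g) + Σ⟨ B ⟩ g          ∎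
    where g = f ∘ suc
  Σ⟨⟩-∪-∩ (outside ∷ A) (inside  ∷ B) f = begin
    (f zero + Σ⟨ A ∪ B ⟩ g) + Σ⟨ A ∩ B ⟩ g  ≈⟨ +-assoc _ _ _ ⟩
    f zero + (Σ⟨ A ∪ B ⟩ g + Σ⟨ A ∩ B ⟩ g)  ≈⟨ +-congˡ (Σ⟨⟩-∪-∩ A B g) ⟩
    f zero + (Σ⟨ A ⟩ g + Σ⟨ B ⟩ g)          ≈⟨ x∙yz≈y∙xz _ _ _ ⟩
    Σ⟨ A ⟩ g + (f zero + Σ⟨ B ⟩ g)          ∎
    where g = f ∘ suc
  Σ⟨⟩-∪-∩ (outside ∷ A) (outside ∷ B) f = Σ⟨⟩-∪-∩ A B (f ∘ suc)


module Neighbourhood {m n} (adj : BiGraph m n) where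

  open import Data.Bool using (true; _∧_)
  open import Data.Bool.Properties using (T-≡; T-∧)
  open import Data.Fin.Subset using (_∈_; _∉_; _⊆_; _∪_; _∩_; ⊥)
  open import Data.Fin.Subset.Properties using (∉⊥; x∈p∪q⁺; x∈p∪q⁻; x∈p∩q⁺; x∈p∩q⁻)
  open import Data.List using (allFin)
  open import Data.List.Membership.Propositional using (lose)
  open import Data.List.Membership.Propositional.Properties using (∈-allFin)
  open import Data.List.Relation.Unary.Any using (satisfied)
  open import Data.List.Relation.Unary.Any.Properties using (any⁺; any⁻)
  open import Data.Product using (∃; _×_; _,_)
  open import Data.Sum using (inj₁; inj₂)
  open import Data.Vec.Properties using (lookup∘tabulate; []=⇒lookup; lookup⇒[]=)
  open import Function using (Equivalence)
  open import Relation.Binary.PropositionalEquality using (_≡_; sym; trans; cong₂)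

  open Equivalence

  ∈N⁺ : ∀ {K c s} → c ∈ K → adj c s ≡ true → s ∈ N adj K
  ∈N⁺ {K} {c} {s} c∈K cs = lookup⇒[]= s (N adj K) (trans (lookup∘tabulate _ s)
    (to T-≡ (any⁺ _ (lose (∈-allFin c) (from T-≡ (cong₂ _∧_ ([]=⇒lookup c∈K) cs))))))

  ∈N⁻ : ∀ {K s} → s ∈ N adj K → ∃ λ c → c ∈ K × adj c s ≡ true
  ∈N⁻ {K} {s} s∈NK
    with satisfied (any⁻ _ (allFin m)
           (from T-≡ (trans (sym (lookup∘tabulate _ s)) ([]=⇒lookup s∈NK))))
  ... | c , Kc∧cs with to T-∧ Kc∧cs
  ... | Kc , cs = c , lookup⇒[]= c K (to T-≡ Kc) , to T-≡ cs

  N-∪ : ∀ A B → N adj (A ∪ B) ⊆ N adj A ∪ N adj B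
  N-∪ A B s∈N with ∈N⁻ s∈N
  ... | c , c∈A∪B , cs with x∈p∪q⁻ A B c∈A∪B
  ...   | inj₁ c∈A = x∈p∪q⁺ (inj₁ (∈N⁺ c∈A cs))
  ...   | inj₂ c∈B = x∈p∪q⁺ (inj₂ (∈N⁺ c∈B cs))

  N-∩ : ∀ A B → N adj (A ∩ B) ⊆ N adj A ∩ N adj B
  N-∩ A B s∈N with ∈N⁻ s∈N
  ... | c , c∈A∩B , cs with x∈p∩q⁻ A B c∈A∩B
  ...   | c∈A , c∈B = x∈p∩q⁺ (∈N⁺ c∈A cs , ∈N⁺ c∈B cs)

  N-mono : ∀ {A B} → A ⊆ B → N adj A ⊆ N adj B
  N-mono A⊆B s∈NA with ∈N⁻ s∈NA
  ... | c , c∈A , cs = ∈N⁺ (A⊆B c∈A) cs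

  ∉N⊥ : ∀ {s} → s ∉ N adj ⊥
  ∉N⊥ s∈N with ∈N⁻ s∈N
  ... | c , c∈⊥ , _ = ∉⊥ c∈⊥

module Hall where

  open import Data.Bool as Bool using (true; false; if_then_else_)
  open import Data.Fin using (Fin; zero; suc; _≟_)
  open import Data.Fin.Properties using (any?)
  open import Data.Fin.Subset using (Subset; inside; outside; _∈_; _∉_; _∪_; _∩_; ⊥; ⁅_⁆; ∣_∣)
  open import Data.Fin.Subset.Properties
    using (∉⊥; drop-there; _∈?_; anySubset?; nonempty?; Empty-unique; ∣⊥∣≡0;
           p⊆p∪q; q⊆p∪q; x∈p∪q⁻; x∈p∩q⁻; x∈⁅y⁆⇒x≡y)
  open import Data.Nat using (ℕ; zero; suc; _+_; _*_; _∸_; _≤_; _<_; z≤n; _<?_)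
  open import Data.Nat.Properties hiding (_≟_)
  open import Data.Product using (∃; _×_; _,_)
  open import Data.Sum using (_⊎_; inj₁; inj₂; [_,_]; map₁)
  open import Data.Vec using ([]; _∷_; here; there)
  open import Function using (_∘_; id; case_of_)
  open import Relation.Binary.PropositionalEquality
    using (_≡_; refl; sym; trans; cong; cong₂; subst; subst₂; module ≡-Reasoning)
  open import Relation.Nullary using (¬_; Dec; yes; no; does; contradiction; _×-dec_)

  open FiniteSums +-0-commutativeMonoid
  open import Algebra.Properties.Monoid.Sum +-0-monoid using (sum-cong-≗)
  open import Algebra.Properties.Semiring.Sum +-*-semiring using (*-distribˡ-sum)

  Σ⟨⟩-mono : ∀ {k} (A B : Subset k) (f : Fin k → ℕ) →
             (∀ {i} → i ∈ A → i ∈ B ⊎ f i ≡ 0) → Σ⟨ A ⟩ f ≤ Σ⟨ B ⟩ f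
  Σ⟨⟩-mono []            []            f h = z≤n
  Σ⟨⟩-mono (inside  ∷ A) (inside  ∷ B) f h =
    +-monoʳ-≤ (f zero) (Σ⟨⟩-mono A B (f ∘ suc) (map₁ drop-there ∘ h ∘ there))
  Σ⟨⟩-mono (inside  ∷ A) (outside ∷ B) f h with h here
  ... | inj₂ f0≡0 rewrite f0≡0 = Σ⟨⟩-mono A B (f ∘ suc) (map₁ drop-there ∘ h ∘ there)
  Σ⟨⟩-mono (outside ∷ A) (inside  ∷ B) f h =
    ≤-trans (Σ⟨⟩-mono A B (f ∘ suc) (map₁ drop-there ∘ h ∘ there)) (m≤n+m _ (f zero))
  Σ⟨⟩-mono (outside ∷ A) (outside ∷ B) f h =
    Σ⟨⟩-mono A B (f ∘ suc) (map₁ drop-there ∘ h ∘ there)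

  Σ⟨⟩-const : ∀ {k} (K : Subset k) x → Σ⟨ K ⟩ (λ _ → x) ≡ ∣ K ∣ * x
  Σ⟨⟩-const []            x = refl
  Σ⟨⟩-const (inside  ∷ K) x = cong (x +_) (Σ⟨⟩-const K x)
  Σ⟨⟩-const (outside ∷ K) x = Σ⟨⟩-const K x

  unit : ∀ {k} → Fin k → Fin k → ℕ
  unit i j = if does (i ≟ j) then 1 else 0

  sum-unit : ∀ {k} (i : Fin k) → sum (unit i) ≡ 1
  sum-unit {suc k} zero    = cong suc (sum-replicate-zero k)
  sum-unit         (suc i) = sum-unit i

  Σ⟨⟩-unit-∈ : ∀ {k} {K : Subset k} {i} → i ∈ K → Σ⟨ K ⟩ (unit i) ≡ 1
  Σ⟨⟩-unit-∈ {K = inside  ∷ K} here        = cong suc (Σ⟨⟩-zero K (λ _ → refl))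
  Σ⟨⟩-unit-∈ {K = inside  ∷ K} (there i∈K) = Σ⟨⟩-unit-∈ i∈K
  Σ⟨⟩-unit-∈ {K = outside ∷ K} (there i∈K) = Σ⟨⟩-unit-∈ i∈K

  Σ⟨⟩-unit-∉ : ∀ {k} (K : Subset k) {i} → i ∉ K → Σ⟨ K ⟩ (unit i) ≡ 0
  Σ⟨⟩-unit-∉ (inside  ∷ K) {zero}  i∉K = contradiction here i∉K
  Σ⟨⟩-unit-∉ (outside ∷ K) {zero}  _   = Σ⟨⟩-zero K (λ _ → refl)
  Σ⟨⟩-unit-∉ (inside  ∷ K) {suc i} i∉K = Σ⟨⟩-unit-∉ K (i∉K ∘ there)
  Σ⟨⟩-unit-∉ (outside ∷ K) {suc i} i∉K = Σ⟨⟩-unit-∉ K (i∉K ∘ there)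

  sum-*-unit : ∀ {k} x (i : Fin k) → sum (λ j → x * unit i j) ≡ x
  sum-*-unit x i = trans (sym (*-distribˡ-sum x (unit i))) (trans (cong (x *_) (sum-unit i)) (*-identityʳ x))

  sum-unit-* : ∀ {k} x (i : Fin k) → sum (λ j → unit i j * x) ≡ x
  sum-unit-* x i = trans (sum-cong-≗ (λ j → *-comm (unit i j) x)) (sum-*-unit x i)

  decrement : ∀ {k} → (Fin k → ℕ) → Fin k → Fin k → ℕ
  decrement f i j = f j ∸ unit i j

  decrement-+-unit : ∀ {k} (f : Fin k → ℕ) {i} → 0 < f i → ∀ j → decrement f i j + unit i j ≡ f j
  decrement-+-unit f {i} 0<fi j with i ≟ j
  ... | yes refl = m∸n+n≡m 0<fi
  ... | no  _    = +-identityʳ _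

  Σ⟨⟩-decrement : ∀ {k} (f : Fin k → ℕ) {i} → 0 < f i → ∀ K →
                  Σ⟨ K ⟩ (decrement f i) + Σ⟨ K ⟩ (unit i) ≡ Σ⟨ K ⟩ f
  Σ⟨⟩-decrement f 0<fi K =
    trans (sym (Σ⟨⟩-+ K _ _)) (Σ⟨⟩-cong K (λ {j} _ → decrement-+-unit f 0<fi j))

  Σ⟨⟩-decrement-∈ : ∀ {k} (f : Fin k → ℕ) {i} → 0 < f i → ∀ {K} → i ∈ K →
                    suc (Σ⟨ K ⟩ (decrement f i)) ≡ Σ⟨ K ⟩ f
  Σ⟨⟩-decrement-∈ f {i} 0<fi {K} i∈K = trans
    (trans (+-comm 1 _) (cong (Σ⟨ K ⟩ (decrement f i) +_) (sym (Σ⟨⟩-unit-∈ i∈K))))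
    (Σ⟨⟩-decrement f 0<fi K)

  Σ⟨⟩-decrement-∉ : ∀ {k} (f : Fin k → ℕ) {i} → 0 < f i → ∀ {K} → i ∉ K →
                    Σ⟨ K ⟩ (decrement f i) ≡ Σ⟨ K ⟩ f
  Σ⟨⟩-decrement-∉ f {i} 0<fi {K} i∉K = trans
    (sym (trans (cong (Σ⟨ K ⟩ (decrement f i) +_) (Σ⟨⟩-unit-∉ K i∉K)) (+-identityʳ _)))
    (Σ⟨⟩-decrement f 0<fi K)

  sum-decrement : ∀ {k} (f : Fin k → ℕ) {i} → 0 < f i → suc (sum (decrement f i)) ≡ sum f
  sum-decrement f {i} 0<fi = begin
    suc (sum (decrement f i))                  ≡⟨ +-comm 1 _ ⟩
    sum (decrement f i) + 1                    ≡⟨ cong (sum (decrement f i) +_) (sum-unit i) ⟨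
    sum (decrement f i) + sum (unit i)         ≡⟨ sum-+ (decrement f i) (unit i) ⟨
    sum (λ j → decrement f i j + unit i j)     ≡⟨ sum-cong-≗ (decrement-+-unit f 0<fi) ⟩
    sum f                                      ∎
    where open ≡-Reasoning

  module _ {m n} (adj : BiGraph m n) where

    open Neighbourhood adj

    HallCondition : (Fin m → ℕ) → (Fin n → ℕ) → Set
    HallCondition a b = ∀ K → Σ⟨ K ⟩ a ≤ Σ⟨ N adj K ⟩ b

    hall⊎violation : ∀ a b → HallCondition a b ⊎ ∃ λ K → Σ⟨ N adj K ⟩ b < Σ⟨ K ⟩ a
    hall⊎violation a b with anySubset? (λ K → Σ⟨ N adj K ⟩ b <? Σ⟨ K ⟩ a)
    ... | yes violation = inj₂ violation
    ... | no ¬violation = inj₁ (λ K → ≮⇒≥ (λ v → ¬violation (K , v)))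

    hall? : ∀ a b → Dec (HallCondition a b)
    hall? a b with hall⊎violation a b
    ... | inj₁ hall       = yes hall
    ... | inj₂ (K , K<NK) = no (λ hall → <⇒≱ K<NK (hall K))

    Tight : (Fin m → ℕ) → (Fin n → ℕ) → Subset m → Set
    Tight a b K = Σ⟨ K ⟩ a ≡ Σ⟨ N adj K ⟩ b

    tight-⊥ : ∀ a b → Tight a b ⊥
    tight-⊥ a b = trans (Σ⟨⊥⟩ a) (sym (Σ⟨⟩-zero (N adj ⊥) (λ s∈N⊥ → contradiction s∈N⊥ ∉N⊥)))

    Σ⟨N⟩-submodular : ∀ (b : Fin n → ℕ) A B →
      Σ⟨ N adj (A ∪ B) ⟩ b + Σ⟨ N adj (A ∩ B) ⟩ b ≤ Σ⟨ N adj A ⟩ b + Σ⟨ N adj B ⟩ b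
    Σ⟨N⟩-submodular b A B = begin
      Σ⟨ N adj (A ∪ B) ⟩ b + Σ⟨ N adj (A ∩ B) ⟩ b
        ≤⟨ +-mono-≤ (Σ⟨⟩-mono _ _ b (inj₁ ∘ N-∪ A B)) (Σ⟨⟩-mono _ _ b (inj₁ ∘ N-∩ A B)) ⟩
      Σ⟨ N adj A ∪ N adj B ⟩ b + Σ⟨ N adj A ∩ N adj B ⟩ b
        ≡⟨ Σ⟨⟩-∪-∩ (N adj A) (N adj B) b ⟩
      Σ⟨ N adj A ⟩ b + Σ⟨ N adj B ⟩ b ∎
      where open ≤-Reasoning

    tight-∪ : ∀ {a b} → HallCondition a b → ∀ {A B} → Tight a b A → Tight a b B → Tight a b (A ∪ B)
    tight-∪ {a} {b} hall {A} {B} tightA tightB = ≤-antisym (hall (A ∪ B)) (+-cancelʳ-≤ _ _ _ (begin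
      Σ⟨ N adj (A ∪ B) ⟩ b + Σ⟨ N adj (A ∩ B) ⟩ b ≤⟨ Σ⟨N⟩-submodular b A B ⟩
      Σ⟨ N adj A ⟩ b + Σ⟨ N adj B ⟩ b             ≡⟨ cong₂ _+_ tightA tightB ⟨
      Σ⟨ A ⟩ a + Σ⟨ B ⟩ a                         ≡⟨ Σ⟨⟩-∪-∩ A B a ⟨
      Σ⟨ A ∪ B ⟩ a + Σ⟨ A ∩ B ⟩ a                 ≤⟨ +-monoʳ-≤ _ (hall (A ∩ B)) ⟩
      Σ⟨ A ∪ B ⟩ a + Σ⟨ N adj (A ∩ B) ⟩ b         ∎))
      where open ≤-Reasoning

    module Augmentation {a b} (hall : HallCondition a b) {c} (0<ac : 0 < a c) where

      open ≤-Reasoning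

      Reachable : Fin n → Set
      Reachable s = adj c s ≡ true × 0 < b s

      reachable? : ∀ s → Dec (Reachable s)
      reachable? s = (adj c s Bool.≟ true) ×-dec (0 <? b s)

      Augmentable : Fin n → Set
      Augmentable s = Reachable s × HallCondition (decrement a c) (decrement b s)

      Shield : Subset m → Set
      Shield K = Tight a b K × c ∉ K

      Shielded : Fin n → Set
      Shielded s = ∃ λ K → Shield K × (Reachable s → s ∈ N adj K)

      violation⇒shielded : ∀ {s} → 0 < b s → ∀ K →
        Σ⟨ N adj K ⟩ (decrement b s) < Σ⟨ K ⟩ (decrement a c) → Shielded s
      violation⇒shielded {s} 0<bs K violated with c ∈? K | s ∈? N adj K
      ... | yes c∈K | yes s∈NK = contradiction
        (≤-pred (subst₂ _≤_ (sym (Σ⟨⟩-decrement-∈ a 0<ac c∈K)) (sym (Σ⟨⟩-decrement-∈ b 0<bs s∈NK)) (hall K)))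
        (<⇒≱ violated)
      ... | yes c∈K | no  s∉NK = contradiction
        (<⇒≤ (subst₂ _≤_ (sym (Σ⟨⟩-decrement-∈ a 0<ac c∈K)) (sym (Σ⟨⟩-decrement-∉ b 0<bs s∉NK)) (hall K)))
        (<⇒≱ violated)
      ... | no  c∉K | no  s∉NK = contradiction
        (subst₂ _≤_ (sym (Σ⟨⟩-decrement-∉ a 0<ac c∉K)) (sym (Σ⟨⟩-decrement-∉ b 0<bs s∉NK)) (hall K))
        (<⇒≱ violated)
      ... | no  c∉K | yes s∈NK = K , (tight , c∉K) , λ _ → s∈NK
        where
        tight : Tight a b K
        tight = ≤-antisym (hall K)
          (subst₂ _≤_ (Σ⟨⟩-decrement-∈ b 0<bs s∈NK) (Σ⟨⟩-decrement-∉ a 0<ac c∉K) violated)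

      shielded : ∀ s → ¬ Augmentable s → Shielded s
      shielded s ¬aug with reachable? s
      ... | no unreachable = ⊥ , (tight-⊥ a b , ∉⊥) , λ r → contradiction r unreachable
      ... | yes r@(_ , 0<bs) with hall⊎violation (decrement a c) (decrement b s)
      ...   | inj₁ hall′         = contradiction (r , hall′) ¬aug
      ...   | inj₂ (K , violated) = violation⇒shielded 0<bs K violated

      common-shield : ∀ {k} (ss : Fin k → Fin n) → (∀ j → Shielded (ss j)) →
                      ∃ λ K → Shield K × (∀ j → Reachable (ss j) → ss j ∈ N adj K)
      common-shield {zero}  ss shielded = ⊥ , (tight-⊥ a b , ∉⊥) , λ ()
      common-shield {suc k} ss shielded
        with shielded zero | common-shield (ss ∘ suc) (shielded ∘ suc)
      ... | K₁ , (tight₁ , c∉K₁) , cover₁ | K₂ , (tight₂ , c∉K₂) , cover₂ =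
        K₁ ∪ K₂ , (tight-∪ hall {K₁} {K₂} tight₁ tight₂ , [ c∉K₁ , c∉K₂ ] ∘ x∈p∪q⁻ K₁ K₂) , λ where
          zero    r → N-mono (p⊆p∪q {p = K₁} K₂) (cover₁ r)
          (suc j) r → N-mono (q⊆p∪q K₁ K₂) (cover₂ j r)

      no-common-shield : ∀ K → Shield K → ¬ (∀ s → Reachable s → s ∈ N adj K)
      no-common-shield K (tight , c∉K) cover = <⇒≱ (+-monoʳ-< (Σ⟨ K ⟩ a) 0<ac) (begin
        Σ⟨ K ⟩ a + a c                              ≡⟨ cong (Σ⟨ K ⟩ a +_) (Σ⟨⁅ c ⁆⟩ a) ⟨
        Σ⟨ K ⟩ a + Σ⟨ ⁅ c ⁆ ⟩ a                     ≡⟨ Σ⟨⟩-∪-∩ K ⁅ c ⁆ a ⟨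
        Σ⟨ K ∪ ⁅ c ⁆ ⟩ a + Σ⟨ K ∩ ⁅ c ⁆ ⟩ a         ≡⟨ cong (Σ⟨ K ∪ ⁅ c ⁆ ⟩ a +_) K∩⁅c⁆-empty ⟩
        Σ⟨ K ∪ ⁅ c ⁆ ⟩ a + 0                        ≡⟨ +-identityʳ _ ⟩
        Σ⟨ K ∪ ⁅ c ⁆ ⟩ a                            ≤⟨ hall (K ∪ ⁅ c ⁆) ⟩
        Σ⟨ N adj (K ∪ ⁅ c ⁆) ⟩ b                    ≤⟨ Σ⟨⟩-mono _ _ b new-servers-empty ⟩
        Σ⟨ N adj K ⟩ b                              ≡⟨ tight ⟨
        Σ⟨ K ⟩ a                                    ≡⟨ +-identityʳ _ ⟨
        Σ⟨ K ⟩ a + 0                                ∎)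
        where
        K∩⁅c⁆-empty : Σ⟨ K ∩ ⁅ c ⁆ ⟩ a ≡ 0
        K∩⁅c⁆-empty = Σ⟨⟩-zero (K ∩ ⁅ c ⁆) λ i∈K∩⁅c⁆ → case x∈p∩q⁻ K ⁅ c ⁆ i∈K∩⁅c⁆ of λ where
          (i∈K , i∈⁅c⁆) → contradiction (subst (_∈ K) (x∈⁅y⁆⇒x≡y c i∈⁅c⁆) i∈K) c∉K
        new-servers-empty : ∀ {s} → s ∈ N adj (K ∪ ⁅ c ⁆) → s ∈ N adj K ⊎ b s ≡ 0
        new-servers-empty {s} s∈N with ∈N⁻ s∈N
        ... | c′ , c′∈K∪⁅c⁆ , c′s with x∈p∪q⁻ K ⁅ c ⁆ c′∈K∪⁅c⁆
        ...   | inj₁ c′∈K = inj₁ (∈N⁺ c′∈K c′s)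
        ...   | inj₂ c′∈⁅c⁆ with 0 <? b s
        ...     | yes 0<bs = inj₁ (cover s (subst (λ x → adj x s ≡ true) (x∈⁅y⁆⇒x≡y c c′∈⁅c⁆) c′s , 0<bs))
        ...     | no  ¬0<bs = inj₂ (n≤0⇒n≡0 (≮⇒≥ ¬0<bs))

      augmenting-server : ∃ Augmentable
      augmenting-server with any? (λ s → reachable? s ×-dec hall? (decrement a c) (decrement b s))
      ... | yes found = found
      ... | no none with common-shield id (λ s → shielded s (λ aug → none (s , aug)))
      ...   | K , shield , cover = contradiction cover (no-common-shield K shield)

    record Allocation (a : Fin m → ℕ) (b : Fin n → ℕ) : Set where
      field
        flow          : Fin m → Fin n → ℕ
        flow-on-edges : ∀ c s → adj c s ≡ false → flow c s ≡ 0
        outflow       : ∀ c → sum (flow c) ≡ a c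
        inflow        : ∀ s → sum (λ c → flow c s) ≤ b s

    empty-allocation : ∀ {a} b → (∀ c → a c ≡ 0) → Allocation a b
    empty-allocation b a≡0 = record
      { flow          = λ _ _ → 0
      ; flow-on-edges = λ _ _ _ → refl
      ; outflow       = λ c → trans (sum-replicate-zero n) (sym (a≡0 c))
      ; inflow        = λ _ → ≤-trans (≤-reflexive (sum-replicate-zero m)) z≤n
      }

    augment : ∀ {a b c s} → adj c s ≡ true → 0 < a c → 0 < b s →
              Allocation (decrement a c) (decrement b s) → Allocation a b
    augment {a} {b} {c} {s} cs 0<ac 0<bs F = record
      { flow          = flow
      ; flow-on-edges = λ c′ s′ ¬c′s′ → cong₂ _+_ (F.flow-on-edges c′ s′ ¬c′s′) (off-edge c′ s′ ¬c′s′)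
      ; outflow       = outflow
      ; inflow        = inflow
      }
      where
      module F = Allocation F
      flow : Fin m → Fin n → ℕ
      flow c′ s′ = F.flow c′ s′ + unit c c′ * unit s s′

      off-edge : ∀ c′ s′ → adj c′ s′ ≡ false → unit c c′ * unit s s′ ≡ 0
      off-edge c′ s′ ¬c′s′ with c ≟ c′ | s ≟ s′
      ... | yes refl | yes refl = contradiction (trans (sym cs) ¬c′s′) λ ()
      ... | yes _    | no  _    = refl
      ... | no  _    | _        = refl

      outflow : ∀ c′ → sum (flow c′) ≡ a c′
      outflow c′ = begin
        sum (flow c′)                                         ≡⟨ sum-+ (F.flow c′) _ ⟩
        sum (F.flow c′) + sum (λ s′ → unit c c′ * unit s s′) ≡⟨ cong₂ _+_ (F.outflow c′) (sum-*-unit _ s) ⟩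
        decrement a c c′ + unit c c′                          ≡⟨ decrement-+-unit a 0<ac c′ ⟩
        a c′                                                  ∎
        where open ≡-Reasoning

      inflow : ∀ s′ → sum (λ c′ → flow c′ s′) ≤ b s′
      inflow s′ = begin
        sum (λ c′ → flow c′ s′)                                          ≡⟨ sum-+ (λ c′ → F.flow c′ s′) _ ⟩
        sum (λ c′ → F.flow c′ s′) + sum (λ c′ → unit c c′ * unit s s′) ≡⟨ cong (_ +_) (sum-unit-* _ c) ⟩
        sum (λ c′ → F.flow c′ s′) + unit s s′                            ≤⟨ +-monoˡ-≤ _ (F.inflow s′) ⟩
        decrement b s s′ + unit s s′                                     ≡⟨ decrement-+-unit b 0<bs s′ ⟩
        b s′                                                             ∎
        where open ≤-Reasoning

    allocation : ∀ D {a b} → sum a ≡ D → HallCondition a b → Allocation a b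
    allocation D {a} {b} total hall with any? (λ c → 0 <? a c)
    ... | no a≡0 = empty-allocation b (λ c → n≤0⇒n≡0 (≮⇒≥ (a≡0 ∘ (c ,_))))
    allocation zero    {a} total hall | yes (c , 0<ac) =
      contradiction (trans (sum-decrement a 0<ac) total) λ ()
    allocation (suc D) {a} total hall | yes (c , 0<ac) with Augmentation.augmenting-server hall 0<ac
    ... | s , (cs , 0<bs) , hall′ =
      augment cs 0<ac 0<bs (allocation D (suc-injective (trans (sum-decrement a 0<ac) total)) hall′)

    RatioBound : Set
    RatioBound = ∀ K → ∣ K ∣ * n ≤ m * ∣ N adj K ∣

    ratio-bound : MaxRatioIs adj m n → RatioBound
    ratio-bound (bound , _) K with nonempty? K
    ... | yes K≢∅ = bound K K≢∅
    ... | no  K≡∅ rewrite Empty-unique K≡∅ | ∣⊥∣≡0 m = z≤n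

    uniform-allocation : RatioBound → Allocation (λ _ → n) (λ _ → m)
    uniform-allocation ratio = allocation _ refl λ K → begin
      Σ⟨ K ⟩ (λ _ → n)           ≡⟨ Σ⟨⟩-const K n ⟩
      ∣ K ∣ * n                  ≤⟨ ratio K ⟩
      m * ∣ N adj K ∣            ≡⟨ *-comm m _ ⟩
      ∣ N adj K ∣ * m            ≡⟨ Σ⟨⟩-const (N adj K) m ⟨
      Σ⟨ N adj K ⟩ (λ _ → m)     ∎
      where open ≤-Reasoning

module ServerFlows where

  open import Data.Bool as Bool using (Bool; true; false; if_then_else_)
  open import Data.Fin using (Fin; zero; suc)
  open import Data.Fin.Properties using (all?; ¬∀⟶∃¬)
  open import Data.Fin.Subset using (Subset; inside; outside; _∈_; _∉_; _⊆_; ∣_∣)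
  open import Data.Fin.Subset.Properties using (_∈?_; x∈⁅y⁆⇒x≡y; p⊆q⇒∣p∣≤∣q∣; ∣⁅x⁆∣≡1)
  import Data.Integer as ℤ
  import Data.Integer.Properties as ℤ
  import Data.List as List
  open import Data.Nat as ℕ using (ℕ; zero; suc)
  import Data.Nat.Properties as ℕ
  import Data.Nat.Coprimality as Coprime
  open import Data.Product using (Σ; ∃; _×_; _,_; proj₁; proj₂)
  open import Data.Sum using (inj₁; inj₂)
  open import Data.Rational
    using (_≟_; ℚ; mkℚ; 0ℚ; 1ℚ; _+_; _*_; _≤_; _<_; 1/_; NonZero; NonNegative; Positive; *≤*; nonNegative)
  open import Data.Rational.Properties
  open import Data.Vec using ([]; _∷_; tabulate)
  open import Data.Vec.Properties using (lookup∘tabulate; []=⇒lookup; lookup⇒[]=)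
  open import Function using (_∘_; id; const)
  open import Relation.Binary.PropositionalEquality
    using (_≡_; refl; sym; trans; cong; cong₂; subst; subst₂; module ≡-Reasoning)
  open import Relation.Nullary using (¬_; yes; no; does; contradiction)
  open import Relation.Nullary.Decidable using (dec-true; _→-dec_)
  open import Relation.Unary using (Decidable)

  open import Algebra.Bundles using (Ring)
  open FiniteSums +-0-commutativeMonoid
  open import Algebra.Properties.Monoid.Sum +-0-monoid using (sum-cong-≗)
  open import Algebra.Properties.Semiring.Sum (Ring.semiring +-*-ring) using (*-distribʳ-sum)
  module ℕΣ = FiniteSums ℕ.+-0-commutativeMonoid

  ℕ→ℚ≡mkℚ : ∀ k → ℕ→ℚ k ≡ mkℚ (ℤ.+ k) 0 (Coprime.sym (Coprime.1-coprimeTo k))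
  ℕ→ℚ≡mkℚ k = normalize-coprime _

  ℕ→ℚ-+ : ∀ a b → ℕ→ℚ (a ℕ.+ b) ≡ ℕ→ℚ a + ℕ→ℚ b
  ℕ→ℚ-+ a b = sym (trans (cong₂ _+_ (ℕ→ℚ≡mkℚ a) (ℕ→ℚ≡mkℚ b))
    (/-cong {q₁ = 1} (trans (cong₂ ℤ._+_ (ℤ.*-identityʳ (ℤ.+ a)) (ℤ.*-identityʳ (ℤ.+ b)))
                            (sym (ℤ.pos-+ a b))) refl))

  ℕ→ℚ-* : ∀ a b → ℕ→ℚ (a ℕ.* b) ≡ ℕ→ℚ a * ℕ→ℚ b
  ℕ→ℚ-* a b = sym (trans (cong₂ _*_ (ℕ→ℚ≡mkℚ a) (ℕ→ℚ≡mkℚ b))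
    (/-cong {q₁ = 1} (sym (ℤ.pos-* a b)) refl))

  ℕ→ℚ-mono : ∀ {a b} → a ℕ.≤ b → ℕ→ℚ a ≤ ℕ→ℚ b
  ℕ→ℚ-mono {a} {b} a≤b = subst₂ _≤_ (sym (ℕ→ℚ≡mkℚ a)) (sym (ℕ→ℚ≡mkℚ b))
    (*≤* (subst₂ ℤ._≤_ (sym (ℤ.*-identityʳ (ℤ.+ a))) (sym (ℤ.*-identityʳ (ℤ.+ b))) (ℤ.+≤+ a≤b)))

  0≤ℕ→ℚ : ∀ k → 0ℚ ≤ ℕ→ℚ k
  0≤ℕ→ℚ k = nonNegative⁻¹ _ {{normalize-nonNeg k 1}}

  ℕ→ℚ-pos : ∀ k → Positive (ℕ→ℚ (suc k))
  ℕ→ℚ-pos k = normalize-pos (suc k) 1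

  ℕ→ℚ-cancelˡ-≤ : ∀ k {p q} → 1 ℕ.≤ k → ℕ→ℚ k * p ≤ ℕ→ℚ k * q → p ≤ q
  ℕ→ℚ-cancelˡ-≤ (suc k) _ = *-cancelˡ-≤-pos (ℕ→ℚ (suc k)) {{ℕ→ℚ-pos k}}

  ℕ→ℚ-suc-* : ∀ k q → ℕ→ℚ (suc k) * q ≡ q + ℕ→ℚ k * q
  ℕ→ℚ-suc-* k q = trans (cong (_* q) (ℕ→ℚ-+ 1 k))
    (trans (*-distribʳ-+ q 1ℚ (ℕ→ℚ k)) (cong (_+ ℕ→ℚ k * q) (*-identityˡ q)))

  ℕ→ℚ-sum : ∀ {k} (f : Fin k → ℕ) → ℕ→ℚ (ℕΣ.sum f) ≡ sum (ℕ→ℚ ∘ f)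
  ℕ→ℚ-sum {zero}  f = refl
  ℕ→ℚ-sum {suc k} f = trans (ℕ→ℚ-+ (f zero) _) (cong (ℕ→ℚ (f zero) +_) (ℕ→ℚ-sum (f ∘ suc)))

  sum-ℕ→ℚ-* : ∀ {k} (f : Fin k → ℕ) q → sum (λ i → ℕ→ℚ (f i) * q) ≡ ℕ→ℚ (ℕΣ.sum f) * q
  sum-ℕ→ℚ-* f q = trans (sym (*-distribʳ-sum q (ℕ→ℚ ∘ f))) (cong (_* q) (sym (ℕ→ℚ-sum f)))

  sum-const : ∀ k q → sum {k} (λ _ → q) ≡ ℕ→ℚ k * q
  sum-const zero    q = sym (*-zeroˡ q)
  sum-const (suc k) q = trans (cong (q +_) (sum-const k q)) (sym (ℕ→ℚ-suc-* k q))

  Σ⟨⟩-const : ∀ {k} (K : Subset k) q → Σ⟨ K ⟩ (λ _ → q) ≡ ℕ→ℚ ∣ K ∣ * q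
  Σ⟨⟩-const []            q = sym (*-zeroˡ q)
  Σ⟨⟩-const (inside  ∷ K) q = trans (cong (q +_) (Σ⟨⟩-const K q)) (sym (ℕ→ℚ-suc-* ∣ K ∣ q))
  Σ⟨⟩-const (outside ∷ K) q = Σ⟨⟩-const K q

  sum-mono-≤ : ∀ {k} {f g : Fin k → ℚ} → (∀ i → f i ≤ g i) → sum f ≤ sum g
  sum-mono-≤ {zero}  f≤g = ≤-refl
  sum-mono-≤ {suc k} f≤g = +-mono-≤ (f≤g zero) (sum-mono-≤ (f≤g ∘ suc))

  sum-mono-< : ∀ {k} {f g : Fin k → ℚ} → (∀ i → f i ≤ g i) → ∀ i → f i < g i → sum f < sum g
  sum-mono-< f≤g zero    fi<gi = +-mono-<-≤ fi<gi (sum-mono-≤ (f≤g ∘ suc))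
  sum-mono-< f≤g (suc i) fi<gi = +-mono-≤-< (f≤g zero) (sum-mono-< (f≤g ∘ suc) i fi<gi)

  sum-squeeze : ∀ {k} {f g : Fin k → ℚ} → (∀ i → f i ≤ g i) → sum g ≤ sum f → ∀ i → f i ≡ g i
  sum-squeeze f≤g Σg≤Σf i =
    ≤-antisym (f≤g i) (≮⇒≥ λ fi<gi → <-irrefl refl (<-≤-trans (sum-mono-< f≤g i fi<gi) Σg≤Σf))

  sumWhere≡sum : ∀ {k} (p : Fin k → Bool) (f : Fin k → ℚ) →
                 sumWhere p f ≡ sum (λ i → if p i then f i else 0ℚ)
  sumWhere≡sum {k} p f = foldr-tabulate id
    where
    foldr-tabulate : ∀ {j} (g : Fin j → Fin k) →
      List.foldr (λ s acc → (if p s then f s else 0ℚ) + acc) 0ℚ (List.tabulate g)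
        ≡ sum (λ i → if p (g i) then f (g i) else 0ℚ)
    foldr-tabulate {zero}  g = refl
    foldr-tabulate {suc j} g = cong ((if p (g zero) then f (g zero) else 0ℚ) +_) (foldr-tabulate (g ∘ suc))

  argmax : ∀ {k} (f : Fin (suc k) → ℚ) → ∃ λ i → ∀ j → f j ≤ f i
  argmax {zero}  f = zero , λ { zero → ≤-refl }
  argmax {suc k} f with argmax (f ∘ suc)
  ... | i , f∘suc≤fi with ≤-total (f zero) (f (suc i))
  ...   | inj₁ f0≤fi = suc i , λ { zero → f0≤fi ; (suc j) → f∘suc≤fi j }
  ...   | inj₂ fi≤f0 = zero  , λ { zero → ≤-refl ; (suc j) → ≤-trans (f∘suc≤fi j) fi≤f0 }

  select : ∀ {k} {P : Fin k → Set} → Decidable P → Subset k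
  select P? = tabulate (does ∘ P?)

  ∈-select⁺ : ∀ {k} {P : Fin k → Set} (P? : Decidable P) {i} → P i → i ∈ select P?
  ∈-select⁺ P? {i} Pi = lookup⇒[]= i _ (trans (lookup∘tabulate _ i) (dec-true (P? i) Pi))

  ∈-select⁻ : ∀ {k} {P : Fin k → Set} (P? : Decidable P) {i} → i ∈ select P? → P i
  ∈-select⁻ P? {i} i∈ with P? i | trans (sym (lookup∘tabulate (does ∘ P?) i)) ([]=⇒lookup i∈)
  ... | yes Pi | _ = Pi

  module _ {m n} (adj : BiGraph m n) where

    -- IsFlowFor constrains x only on edges; restrict replaces the off-edge values by 0.
    restrict : (Fin m → Fin n → ℚ) → Fin m → Fin n → ℚ
    restrict x c s = if adj c s then x c s else 0ℚ

    module _ {α x} (flow : IsFlowFor adj α x) where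

      outflow : ∀ c → sum (restrict x c) ≡ 1ℚ
      outflow c = trans (sym (sumWhere≡sum (adj c) (x c))) (proj₁ (proj₂ flow) c)

      inflow : ∀ s → sum (λ c → restrict x c s) ≡ α s
      inflow s = trans (sym (sumWhere≡sum (Nˢ adj s) (λ c → x c s))) (proj₂ (proj₂ flow) s)

      flow-total : sum α ≡ ℕ→ℚ m
      flow-total = begin
        sum α                                     ≡⟨ sum-cong-≗ (sym ∘ inflow) ⟩
        sum (λ s → sum (λ c → restrict x c s))    ≡⟨ sum-swap (restrict x) ⟨
        sum (λ c → sum (restrict x c))            ≡⟨ sum-cong-≗ outflow ⟩
        sum {m} (λ _ → 1ℚ)                        ≡⟨ sum-const m 1ℚ ⟩
        ℕ→ℚ m * 1ℚ                                ≡⟨ *-identityʳ _ ⟩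
        ℕ→ℚ m                                     ∎
        where open ≡-Reasoning

  module TopLevel {m n} (adj : BiGraph m (suc n)) {β x} (flow : IsFlowFor adj β x)
    (balanced : ∀ c s → adj c s ≡ true → ¬ InArgmin adj β c s → x c s ≡ 0ℚ) where

    open Neighbourhood adj using (∈N⁻)

    top : Fin (suc n)
    top = proj₁ (argmax β)

    M : ℚ
    M = β top

    β≤M : ∀ s → β s ≤ M
    β≤M = proj₂ (argmax β)

    at-top? : Decidable (λ s → β s ≡ M)
    at-top? s = β s ≟ M

    T : Subset (suc n)
    T = select at-top?

    drains-into-T? : Decidable (λ c → ∀ s → adj c s ≡ true → s ∈ T)
    drains-into-T? c = all? (λ s → (adj c s Bool.≟ true) →-dec (s ∈? T))

    K : Subset m
    K = select drains-into-T?

    K-inside : ∀ {c s} → c ∈ K → adj c s ≡ true → s ∈ T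
    K-inside c∈K = ∈-select⁻ drains-into-T? c∈K _

    K-outside : ∀ {c} → c ∉ K → ∃ λ s → adj c s ≡ true × s ∉ T
    K-outside {c} c∉K
      with ¬∀⟶∃¬ _ _ (λ s → (adj c s Bool.≟ true) →-dec (s ∈? T)) (c∉K ∘ ∈-select⁺ drains-into-T?)
    ... | s , ¬[cs⇒s∈T] with adj c s Bool.≟ true
    ...   | yes cs  = s , cs , ¬[cs⇒s∈T] ∘ const
    ...   | no  ¬cs = contradiction (λ cs → contradiction cs ¬cs) ¬[cs⇒s∈T]

    X : Fin m → Fin (suc n) → ℚ
    X = restrict adj x

    K-sends-all-into-T : ∀ {c} → c ∈ K → Σ⟨ T ⟩ (X c) ≡ 1ℚ
    K-sends-all-into-T {c} c∈K = trans (Σ⟨⟩≈sum T vanishes) (outflow adj flow c)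
      where
      vanishes : ∀ {s} → s ∉ T → X c s ≡ 0ℚ
      vanishes {s} s∉T with adj c s in cs
      ... | true  = contradiction (K-inside c∈K cs) s∉T
      ... | false = refl

    others-send-nothing-into-T : ∀ {c} → c ∉ K → Σ⟨ T ⟩ (X c) ≡ 0ℚ
    others-send-nothing-into-T {c} c∉K with K-outside c∉K
    ... | s′ , cs′ , s′∉T = Σ⟨⟩-zero T vanishes
      where
      vanishes : ∀ {s} → s ∈ T → X c s ≡ 0ℚ
      vanishes {s} s∈T with adj c s in cs
      ... | false = refl
      ... | true  = balanced c s cs λ (_ , βs≤) →
        s′∉T (∈-select⁺ at-top? (≤-antisym (β≤M s′) (subst (_≤ β s′) (∈-select⁻ at-top? s∈T) (βs≤ s′ cs′))))

    T-mass≡∣K∣ : Σ⟨ T ⟩ β ≡ ℕ→ℚ ∣ K ∣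
    T-mass≡∣K∣ = begin
      Σ⟨ T ⟩ β                              ≡⟨ Σ⟨⟩-cong T (λ {s} _ → sym (inflow adj flow s)) ⟩
      Σ⟨ T ⟩ (λ s → sum (λ c → X c s))      ≡⟨ Σ⟨⟩-sum-swap T X ⟩
      sum (λ c → Σ⟨ T ⟩ (X c))              ≡⟨ Σ⟨⟩≈sum K others-send-nothing-into-T ⟨
      Σ⟨ K ⟩ (λ c → Σ⟨ T ⟩ (X c))           ≡⟨ Σ⟨⟩-cong K K-sends-all-into-T ⟩
      Σ⟨ K ⟩ (λ _ → 1ℚ)                     ≡⟨ Σ⟨⟩-const K 1ℚ ⟩
      ℕ→ℚ ∣ K ∣ * 1ℚ                         ≡⟨ *-identityʳ _ ⟩
      ℕ→ℚ ∣ K ∣                              ∎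
      where open ≡-Reasoning

    T-mass≡∣T∣M : Σ⟨ T ⟩ β ≡ ℕ→ℚ ∣ T ∣ * M
    T-mass≡∣T∣M = trans (Σ⟨⟩-cong T (∈-select⁻ at-top?)) (Σ⟨⟩-const T M)

    N[K]⊆T : N adj K ⊆ T
    N[K]⊆T s∈NK with ∈N⁻ s∈NK
    ... | c , c∈K , cs = K-inside c∈K cs

    1≤∣T∣ : 1 ℕ.≤ ∣ T ∣
    1≤∣T∣ = subst (ℕ._≤ ∣ T ∣) (∣⁅x⁆∣≡1 top)
      (p⊆q⇒∣p∣≤∣q∣ λ i∈⁅top⁆ → ∈-select⁺ at-top? (cong β (x∈⁅y⁆⇒x≡y top i∈⁅top⁆)))

    M-bound : Hall.RatioBound adj → M * ℕ→ℚ (suc n) ≤ ℕ→ℚ m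
    M-bound ratio = ℕ→ℚ-cancelˡ-≤ ∣ T ∣ 1≤∣T∣ (begin
      ℕ→ℚ ∣ T ∣ * (M * ℕ→ℚ (suc n))     ≡⟨ *-assoc (ℕ→ℚ ∣ T ∣) M _ ⟨
      ℕ→ℚ ∣ T ∣ * M * ℕ→ℚ (suc n)       ≡⟨ cong (_* ℕ→ℚ (suc n)) (trans (sym T-mass≡∣T∣M) T-mass≡∣K∣) ⟩
      ℕ→ℚ ∣ K ∣ * ℕ→ℚ (suc n)           ≡⟨ ℕ→ℚ-* ∣ K ∣ (suc n) ⟨
      ℕ→ℚ (∣ K ∣ ℕ.* suc n)             ≤⟨ ℕ→ℚ-mono (ℕ.≤-trans (ratio K) (ℕ.*-monoʳ-≤ m (p⊆q⇒∣p∣≤∣q∣ N[K]⊆T))) ⟩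
      ℕ→ℚ (m ℕ.* ∣ T ∣)                 ≡⟨ cong ℕ→ℚ (ℕ.*-comm m ∣ T ∣) ⟩
      ℕ→ℚ (∣ T ∣ ℕ.* m)                 ≡⟨ ℕ→ℚ-* ∣ T ∣ m ⟩
      ℕ→ℚ ∣ T ∣ * ℕ→ℚ m                 ∎)
      where open ≤-Reasoning

  module _ {m n} (adj : BiGraph m (suc n)) (ratio : Hall.RatioBound adj) where

    balanced⇒uniform : ∀ {β} → IsBalanced adj β → ∀ s → β s * ℕ→ℚ (suc n) ≡ ℕ→ℚ m
    balanced⇒uniform {β} (_ , x , flow , balanced) s = begin
      β s * ℕ→ℚ (suc n)          ≡⟨ cong (_* ℕ→ℚ (suc n)) (β≡M s) ⟩
      M * ℕ→ℚ (suc n)            ≡⟨ *-comm M _ ⟩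
      ℕ→ℚ (suc n) * M            ≡⟨ sum-const (suc n) M ⟨
      sum {suc n} (λ _ → M)      ≡⟨ sum-cong-≗ (sym ∘ β≡M) ⟩
      sum β                      ≡⟨ flow-total adj flow ⟩
      ℕ→ℚ m                      ∎
      where
      open TopLevel adj flow balanced
      open ≡-Reasoning
      β≡M : ∀ s → β s ≡ M
      β≡M = sum-squeeze β≤M (subst₂ _≤_ (trans (*-comm M _) (sym (sum-const (suc n) M)))
                                         (sym (flow-total adj flow)) (M-bound ratio))

    -- The allocation and r = 1/(n+1) are parameters rather than concrete terms: otherwise
    -- conversion checking unfolds the Hall recursion and the gcd normalisation of ℚ.
    module ScaledAllocation (A : Hall.Allocation adj (λ _ → suc n) (λ _ → m))
      (r : ℚ) (0≤r : 0ℚ ≤ r) (d*r≡1 : ℕ→ℚ (suc n) * r ≡ 1ℚ) where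

      module A = Hall.Allocation A

      instance
        r≥0 : NonNegative r
        r≥0 = nonNegative 0≤r

      0≤ℕ→ℚ*r : ∀ k → 0ℚ ≤ ℕ→ℚ k * r
      0≤ℕ→ℚ*r k = subst (_≤ ℕ→ℚ k * r) (*-zeroˡ r) (*-monoʳ-≤-nonNeg r (0≤ℕ→ℚ k))

      μ : ℚ
      μ = ℕ→ℚ m * r

      μ*d≡m : μ * ℕ→ℚ (suc n) ≡ ℕ→ℚ m
      μ*d≡m = trans (*-assoc (ℕ→ℚ m) r _) (trans (cong (ℕ→ℚ m *_) (trans (*-comm r _) d*r≡1)) (*-identityʳ _))

      x : Fin m → Fin (suc n) → ℚ
      x c s = ℕ→ℚ (A.flow c s) * r

      0≤x : ∀ c s → adj c s ≡ true → 0ℚ ≤ x c s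
      0≤x c s _ = 0≤ℕ→ℚ*r (A.flow c s)

      restrict-x : ∀ c s → restrict adj x c s ≡ x c s
      restrict-x c s with adj c s in cs
      ... | true  = refl
      ... | false = trans (sym (*-zeroˡ r)) (cong (λ k → ℕ→ℚ k * r) (sym (A.flow-on-edges c s cs)))

      x-out : ∀ c → sumWhere (adj c) (x c) ≡ 1ℚ
      x-out c = begin
        sumWhere (adj c) (x c)          ≡⟨ sumWhere≡sum (adj c) (x c) ⟩
        sum (restrict adj x c)          ≡⟨ sum-cong-≗ (restrict-x c) ⟩
        sum (x c)                       ≡⟨ sum-ℕ→ℚ-* (A.flow c) r ⟩
        ℕ→ℚ (ℕΣ.sum (A.flow c)) * r     ≡⟨ cong (λ k → ℕ→ℚ k * r) (A.outflow c) ⟩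
        ℕ→ℚ (suc n) * r                 ≡⟨ d*r≡1 ⟩
        1ℚ                              ∎
        where open ≡-Reasoning

      x-in : Fin (suc n) → ℚ
      x-in s = sumWhere (Nˢ adj s) (λ c → x c s)

      x-in≤μ : ∀ s → x-in s ≤ μ
      x-in≤μ s = begin
        x-in s                                   ≡⟨ sumWhere≡sum (Nˢ adj s) (λ c → x c s) ⟩
        sum (λ c → restrict adj x c s)           ≡⟨ sum-cong-≗ (λ c → restrict-x c s) ⟩
        sum (λ c → x c s)                        ≡⟨ sum-ℕ→ℚ-* (λ c → A.flow c s) r ⟩
        ℕ→ℚ (ℕΣ.sum (λ c → A.flow c s)) * r      ≤⟨ *-monoʳ-≤-nonNeg r (ℕ→ℚ-mono (A.inflow s)) ⟩
        μ                                        ∎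
        where open ≤-Reasoning

      x-in≡μ : ∀ s → x-in s ≡ μ
      x-in≡μ = sum-squeeze x-in≤μ (≤-reflexive (begin
        sum {suc n} (λ _ → μ)       ≡⟨ sum-const (suc n) μ ⟩
        ℕ→ℚ (suc n) * μ             ≡⟨ *-comm (ℕ→ℚ (suc n)) μ ⟩
        μ * ℕ→ℚ (suc n)             ≡⟨ μ*d≡m ⟩
        ℕ→ℚ m                       ≡⟨ flow-total adj {x-in} {x} (0≤x , x-out , λ _ → refl) ⟨
        sum x-in                    ∎))
        where open ≡-Reasoning

      x-flow : IsFlowFor adj (λ _ → μ) x
      x-flow = 0≤x , x-out , x-in≡μ

      all-at-argmin : ∀ c s → adj c s ≡ true → ¬ InArgmin adj (λ _ → μ) c s → x c s ≡ 0ℚ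
      all-at-argmin c s cs ¬argmin = contradiction (cs , λ _ _ → ≤-refl) ¬argmin

      uniform-balanced-flow : Σ (Fin (suc n) → ℚ) λ α → IsBalanced adj α × (∀ s → α s * ℕ→ℚ (suc n) ≡ ℕ→ℚ m)
      uniform-balanced-flow = (λ _ → μ) , ((λ _ → 0≤ℕ→ℚ*r m) , x , x-flow , all-at-argmin) , λ _ → μ*d≡m

    uniform-flow : Σ (Fin (suc n) → ℚ) λ α → IsBalanced adj α × (∀ s → α s * ℕ→ℚ (suc n) ≡ ℕ→ℚ m)
    uniform-flow =
      ScaledAllocation.uniform-balanced-flow (Hall.uniform-allocation adj ratio) (1/ d) 0≤1/d (*-inverseʳ d)
      where
      d : ℚ
      d = ℕ→ℚ (suc n)
      instance
        d≢0 : NonZero d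
        d≢0 = pos⇒nonZero d {{ℕ→ℚ-pos n}}
      0≤1/d : 0ℚ ≤ 1/ d
      0≤1/d = nonNegative⁻¹ _ {{pos⇒nonNeg (1/ d) {{1/pos⇒pos d {{ℕ→ℚ-pos n}}}}}}

open import Data.Bool using (true)
open import Data.Fin using (Fin; fromℕ<)
open import Data.Nat using (ℕ; zero; suc; _≥_)
open import Data.Product using (Σ; _×_; ∃; _,_)
open import Data.Rational using (ℚ; _*_)
open import Relation.Binary.PropositionalEquality using (_≡_)
open Hall using (ratio-bound)
open ServerFlows using (uniform-flow; balanced⇒uniform)

corollary19 : (m n : ℕ) (adj : BiGraph m n)
    → m ≥ 1
    → (∀ (c : Fin m) → ∃ (λ (s : Fin n) → adj c s ≡ true))
    → MaxRatioIs adj m n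
    → Σ (Fin n → ℚ) (λ α → IsBalanced adj α × (∀ s → α s * ℕ→ℚ n ≡ ℕ→ℚ m))
      × (∀ (β : Fin n → ℚ) → IsBalanced adj β → ∀ s → β s * ℕ→ℚ n ≡ ℕ→ℚ m)
corollary19 m zero adj m≥1 has-neighbour _ with has-neighbour (fromℕ< m≥1)
... | () , _
corollary19 m (suc n) adj _ _ max-ratio =
  uniform-flow adj (ratio-bound adj max-ratio) ,
  λ _ → balanced⇒uniform adj (ratio-bound adj max-ratio)
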